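{- Let $\mathrm{ftm}(n)$ be $0$ if the Fibonacci (Zeckendorf) representation of $n$ has an even number of $1$'s and $1$ otherwise, and let $\mathrm{sum}_{\mathrm{ftm}}(n)=\sum_{i=0}^{n}\mathrm{ftm}(i)$. For an integer $r\ge0$ let $n(r)$ be the integer whose Fibonacci representation is the word $(100100)^r$. Then $$\mathrm{sum}_{\mathrm{ftm}}(n(r)) = a(r)+b(r),\quad\text{where } a(r)=\frac{F_{6r+2}-1}{4},\ \ b(r)=\frac{F_{6r+8}-13F_{6r+2}-32r-8}{32}.$$
   Context: Fibonacci numbers: $F_0=0$, $F_1=1$, $F_n=F_{n-1}+F_{n-2}$. The Fibonacci (Zeckendorf) representation of $n$ is the unique binary word $a_k\cdots a_0$ with no two consecutive $1$'s (and no leading zeros) such that $n=\sum_i a_iF_{i+2}$; a word with leading zeros is read the same way. Thus $n(r)=\sum_{j=0}^{r-1}(F_{6j+4}+F_{6j+7})$. -}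

module Defs where

open import Data.Nat using (ℕ; zero; suc; _+_; _∸_; _≤ᵇ_)
open import Data.Bool using (Bool; true; false; if_then_else_; not)
open import Data.List using (List; []; _∷_; [_]; length; dropWhile; concat; replicate; map; upTo; filter)
open import Data.Bool.Properties using (T?)
open import Data.Nat.ListAction using (sum)

F : ℕ → ℕ
F zero = 0
F (suc zero) = 1
F (suc (suc n)) = F (suc n) + F n

-- Value of a binary word a_k ⋯ a_0 (head = most significant digit a_k),
-- read as  Σ a_i F_{i+2}  (leading zeros allowed).
val : List Bool → ℕ
val [] = 0
val (b ∷ w) = (if b then F (length w + 2) else 0) + val w

zw : ℕ → ℕ → List Bool
zw zero m = [ 1 ≤ᵇ m ]
zw (suc k) m = if F (k + 3) ≤ᵇ m then true ∷ zw k (m ∸ F (k + 3)) else false ∷ zw k m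

-- Zeckendorf (Fibonacci) representation of n: greedy digits with leading
-- zeros removed (n < F (n+3), so n+1 digit positions suffice; 0 ↦ empty word).
zeck : ℕ → List Bool
zeck n = dropWhile (λ b → T? (not b)) (zw n n)

ones : List Bool → ℕ
ones [] = 0
ones (true ∷ w) = suc (ones w)
ones (false ∷ w) = ones w

parity : ℕ → ℕ
parity zero = 0
parity (suc zero) = 1
parity (suc (suc n)) = parity n

ftm : ℕ → ℕ
ftm n = parity (ones (zeck n))

sumFtm : ℕ → ℕ
sumFtm n = sum (map ftm (upTo (suc n)))

nr : ℕ → ℕ
nr r = val (concat (replicate r (true ∷ false ∷ false ∷ true ∷ false ∷ false ∷ [])))

{-# OPTIONS --safe #-}
module Submission where

-- Let Φ k be the number of Fibonacci words of length k + 1 with an odd number of ones. Since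
-- the word of F (k + 3) + d is 1 followed by the word of d, counting up to F (k + 3) + d gives
-- Φ k + d minus the count up to d. For F (k + 5) = F (k + 4) + F (k + 3) this yields
-- Φ (k + 2) + Φ k = Φ (k + 1) + F (k + 3), hence Φ (k + 3) + Φ k = F (k + 5) and, by period 6,
-- 2 Φ (6r + 1) = F (6r + 4) + 1. As n(r + 1) = F (6r + 7) + F (6r + 4) + n(r), two such flips give
-- sum_ftm(n(r + 1)) + 1 = sum_ftm(n(r)) + F (6r + 6), so 4 sum_ftm(n(r)) + 4r + 2 = F (6r + 3).
-- The claim follows with F (6r + 2) ≡ 1 (mod 4) and F (6r + 8) = 5 F (6r + 2) + 8 F (6r + 3).

open import Data.List using ([]; _∷_)
open import Data.Product using (∃; ∃₂; _×_; _,_)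
open import Relation.Binary.PropositionalEquality
  using (_≡_; refl; sym; trans; cong; cong₂; subst; module ≡-Reasoning)
open import Defs

-- The natural-number operators are opened only inside this module: the theorem uses those of ℤ.
module _ where
  open import Data.Bool using (Bool; true; false; not)
  open import Data.Bool.Properties using (T?)
  open import Data.List using (List; [_]; _++_; _∷ʳ_; length; concat; replicate; map; upTo; dropWhile)
  open import Data.List.Properties using (map-++; map-cong-local; upTo-∷ʳ)
  open import Data.List.Relation.Unary.All as All using ()
  open import Data.List.Relation.Unary.All.Properties using (all-upTo)
  open import Data.Nat hiding (parity)
  open import Data.Nat.Properties
  open import Algebra.Properties.CommutativeSemigroup +-commutativeSemigroup using (interchange)
  open import Data.Nat.ListAction using (sum)
  open import Data.Nat.ListAction.Properties using (sum-++)
  open import Data.Nat.Tactic.RingSolver using (solve-∀; solve)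
  open import Data.Sum using (inj₁; inj₂)
  open import Relation.Nullary using (contradiction)
  open import Relation.Nullary.Reflects using (ofʸ; ofⁿ)
  open ≡-Reasoning

  +-telescope : ∀ a b c {d x y} → a + b ≡ c + x → c + d ≡ b + y → a + d ≡ x + y
  +-telescope a b c {d} {x} {y} a+b≡c+x c+d≡b+y = +-cancelʳ-≡ (b + c) (a + d) (x + y) (begin
    a + d + (b + c)   ≡⟨ solve (a ∷ b ∷ c ∷ d ∷ []) ⟩
    (a + b) + (c + d) ≡⟨ cong₂ _+_ a+b≡c+x c+d≡b+y ⟩
    (c + x) + (b + y) ≡⟨ solve (b ∷ c ∷ x ∷ y ∷ []) ⟩
    x + y + (b + c)   ∎)

  sum-map-upTo-suc : ∀ (f : ℕ → ℕ) n → sum (map f (upTo (suc n))) ≡ sum (map f (upTo n)) + f n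
  sum-map-upTo-suc f n = begin
    sum (map f (upTo (suc n)))       ≡⟨ cong (λ xs → sum (map f xs)) (sym (upTo-∷ʳ n)) ⟩
    sum (map f (upTo n ∷ʳ n))        ≡⟨ cong sum (map-++ f (upTo n) [ n ]) ⟩
    sum (map f (upTo n) ++ [ f n ])  ≡⟨ sum-++ (map f (upTo n)) [ f n ] ⟩
    sum (map f (upTo n)) + (f n + 0) ≡⟨ cong (sum (map f (upTo n)) +_) (+-identityʳ (f n)) ⟩
    sum (map f (upTo n)) + f n       ∎

  sum-map-upTo-cong : ∀ {f g : ℕ → ℕ} n → (∀ {i} → i < n → f i ≡ g i) →
                      sum (map f (upTo n)) ≡ sum (map g (upTo n))
  sum-map-upTo-cong n f≡g = cong sum (map-cong-local (All.map f≡g (all-upTo n)))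

  F-+ : ∀ m n → F (m + suc n) ≡ F m * F n + F (suc m) * F (suc n)
  F-+ zero n = sym (+-identityʳ (F (suc n)))
  F-+ (suc zero) n =
    trans (+-comm (F (suc n)) (F n)) (sym (cong₂ _+_ (+-identityʳ (F n)) (+-identityʳ (F (suc n)))))
  F-+ (suc (suc m)) n =
    trans (cong₂ _+_ (F-+ (suc m) n) (F-+ m n)) (recurrence (F m) (F (suc m)) (F n) (F (suc n)))
    where
    recurrence : ∀ a b x y → (b * x + (b + a) * y) + (a * x + b * y) ≡ (b + a) * x + ((b + a) + b) * y
    recurrence = solve-∀

  F[6+n] : ∀ n → F (6 + n) ≡ 5 * F n + 8 * F (1 + n)
  F[6+n] = F-+ 5

  F[9+n] : ∀ n → F (9 + n) ≡ 4 * F (6 + n) + F (3 + n)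
  F[9+n] n =
    trans (F-+ 8 n) (trans (coefficients (F n) (F (1 + n))) (sym (cong₂ (λ a b → 4 * a + b) (F-+ 5 n) (F-+ 2 n))))
    where
    coefficients : ∀ x y → 21 * x + 34 * y ≡ 4 * (5 * x + 8 * y) + (1 * x + 2 * y)
    coefficients = solve-∀

  2F[8+n]+F[3+n] : ∀ n → 2 * F (8 + n) + F (3 + n) ≡ F (9 + n) + 2 * F (5 + n)
  2F[8+n]+F[3+n] n =
    trans (cong₂ (λ a b → 2 * a + b) (F-+ 7 n) (F-+ 2 n))
          (trans (coefficients (F n) (F (1 + n))) (sym (cong₂ (λ a b → a + 2 * b) (F-+ 8 n) (F-+ 4 n))))
    where
    coefficients : ∀ x y → 2 * (13 * x + 21 * y) + (1 * x + 2 * y) ≡ 21 * x + 34 * y + 2 * (3 * x + 5 * y)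
    coefficients = solve-∀

  F-≤-suc : ∀ n → F n ≤ F (suc n)
  F-≤-suc zero = z≤n
  F-≤-suc (suc n) = m≤m+n (F (suc n)) (F n)

  F-mono-≤ : ∀ {m n} → m ≤ n → F m ≤ F n
  F-mono-≤ m≤n = mono (≤⇒≤′ m≤n)
    where
    mono : ∀ {m n} → m ≤′ n → F m ≤ F n
    mono ≤′-refl = ≤-refl
    mono {n = suc n} (≤′-step m≤′n) = ≤-trans (mono m≤′n) (F-≤-suc n)

  n<F[3+n] : ∀ n → n < F (3 + n)
  n<F[3+n] zero = s≤s z≤n
  n<F[3+n] (suc n) =
    ≤-trans (+-mono-≤ (F-mono-≤ {1} {2 + n} (s≤s z≤n)) (n<F[3+n] n))
            (≤-reflexive (+-comm (F (2 + n)) (F (3 + n))))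

  zw-suc-below : ∀ k {m} → m < F (3 + k) → zw (suc k) m ≡ false ∷ zw k m
  zw-suc-below k {m} m<F with F (k + 3) ≤ᵇ m | ≤ᵇ-reflects-≤ (F (k + 3)) m
  ... | false | _ = refl
  ... | true | ofʸ F≤m = contradiction (subst (λ j → F j ≤ m) (+-comm k 3) F≤m) (<⇒≱ m<F)

  zw-suc-F+ : ∀ k d → zw (suc k) (F (3 + k) + d) ≡ true ∷ zw k d
  zw-suc-F+ k d = subst (λ j → zw (suc k) (F j + d) ≡ true ∷ zw k d) (+-comm k 3) leading-one
    where
    leading-one : zw (suc k) (F (k + 3) + d) ≡ true ∷ zw k d
    leading-one with F (k + 3) ≤ᵇ F (k + 3) + d | ≤ᵇ-reflects-≤ (F (k + 3)) (F (k + 3) + d)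
    ... | true | _ = cong (λ m → true ∷ zw k m) (m+n∸m≡n (F (k + 3)) d)
    ... | false | ofⁿ F≰ = contradiction (m≤m+n (F (k + 3)) d) F≰

  parity-suc+parity : ∀ n → parity (suc n) + parity n ≡ 1
  parity-suc+parity zero = refl
  parity-suc+parity (suc zero) = refl
  parity-suc+parity (suc (suc n)) = parity-suc+parity n

  ones-dropWhile-false : ∀ w → ones (dropWhile (λ b → T? (not b)) w) ≡ ones w
  ones-dropWhile-false [] = refl
  ones-dropWhile-false (true ∷ w) = refl
  ones-dropWhile-false (false ∷ w) = ones-dropWhile-false w

  digitParity : ℕ → ℕ → ℕ
  digitParity k m = parity (ones (zw k m))

  digitParity-suc-below : ∀ k {m} → m < F (3 + k) → digitParity (suc k) m ≡ digitParity k m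
  digitParity-suc-below k m<F = cong (λ w → parity (ones w)) (zw-suc-below k m<F)

  digitParity-suc-F+ : ∀ k d → digitParity (suc k) (F (3 + k) + d) + digitParity k d ≡ 1
  digitParity-suc-F+ k d rewrite zw-suc-F+ k d = parity-suc+parity (ones (zw k d))

  digitParity-stable : ∀ {k l m} → k ≤′ l → m < F (3 + k) → digitParity l m ≡ digitParity k m
  digitParity-stable ≤′-refl _ = refl
  digitParity-stable {l = suc l} (≤′-step k≤′l) m<F =
    trans (digitParity-suc-below l (<-≤-trans m<F (F-mono-≤ (+-monoʳ-≤ 3 (≤′⇒≤ k≤′l)))))
          (digitParity-stable k≤′l m<F)

  digitParity-irrelevant : ∀ k l {m} → m < F (3 + k) → m < F (3 + l) → digitParity k m ≡ digitParity l m
  digitParity-irrelevant k l m<F[3+k] m<F[3+l] with ≤-total k l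
  ... | inj₁ k≤l = sym (digitParity-stable (≤⇒≤′ k≤l) m<F[3+k])
  ... | inj₂ l≤k = digitParity-stable (≤⇒≤′ l≤k) m<F[3+l]

  ftm≡digitParity : ∀ k {i} → i < F (3 + k) → ftm i ≡ digitParity k i
  ftm≡digitParity k {i} i<F =
    trans (cong parity (ones-dropWhile-false (zw i i))) (digitParity-irrelevant i k (n<F[3+n] i) i<F)

  oddCount : ℕ → ℕ → ℕ
  oddCount k n = sum (map (digitParity k) (upTo n))

  -- The numbers below F (3 + k) are exactly the values of the Fibonacci words of length k + 1.
  oddWords : ℕ → ℕ
  oddWords k = oddCount k (F (3 + k))

  sumFtm≡oddCount : ∀ k {n} → n < F (3 + k) → sumFtm n ≡ oddCount k (suc n)
  sumFtm≡oddCount k {n} n<F =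
    sum-map-upTo-cong (suc n) (λ i<1+n → ftm≡digitParity k (≤-<-trans (≤-pred i<1+n) n<F))

  oddCount-suc-below : ∀ k {n} → n ≤ F (3 + k) → oddCount (suc k) n ≡ oddCount k n
  oddCount-suc-below k {n} n≤F = sum-map-upTo-cong n (λ i<n → digitParity-suc-below k (<-≤-trans i<n n≤F))

  -- The numbers in [F (3 + k), F (3 + k) + d) have the words of [0, d) with a leading 1.
  oddCount-split : ∀ k d → oddCount (suc k) (F (3 + k) + d) + oddCount k d ≡ oddWords k + d
  oddCount-split k zero = cong (_+ 0) (begin
    oddCount (suc k) (F (3 + k) + 0) ≡⟨ cong (oddCount (suc k)) (+-identityʳ (F (3 + k))) ⟩
    oddCount (suc k) (F (3 + k))     ≡⟨ oddCount-suc-below k ≤-refl ⟩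
    oddWords k                       ∎)
  oddCount-split k (suc d) = begin
    oddCount (suc k) (F (3 + k) + suc d) + oddCount k (suc d)
      ≡⟨ cong (λ n → oddCount (suc k) n + oddCount k (suc d)) (+-suc (F (3 + k)) d) ⟩
    oddCount (suc k) (suc N) + oddCount k (suc d)
      ≡⟨ cong₂ _+_ (sum-map-upTo-suc (digitParity (suc k)) N) (sum-map-upTo-suc (digitParity k) d) ⟩
    (oddCount (suc k) N + digitParity (suc k) N) + (oddCount k d + digitParity k d)
      ≡⟨ interchange (oddCount (suc k) N) _ _ _ ⟩
    (oddCount (suc k) N + oddCount k d) + (digitParity (suc k) N + digitParity k d)
      ≡⟨ cong₂ _+_ (oddCount-split k d) (digitParity-suc-F+ k d) ⟩
    oddWords k + d + 1
      ≡⟨ trans (+-comm _ 1) (sym (+-suc (oddWords k) d)) ⟩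
    oddWords k + suc d
      ∎
    where
    N = F (3 + k) + d

  oddWords-rec : ∀ k → oddWords (2 + k) + oddWords k ≡ oddWords (1 + k) + F (3 + k)
  oddWords-rec k =
    trans (cong (oddWords (2 + k) +_) (sym (oddCount-suc-below k ≤-refl))) (oddCount-split (suc k) (F (3 + k)))

  oddWords-+3 : ∀ k → oddWords (3 + k) + oddWords k ≡ F (5 + k)
  oddWords-+3 k =
    +-telescope (oddWords (3 + k)) (oddWords (1 + k)) (oddWords (2 + k)) (oddWords-rec (1 + k)) (oddWords-rec k)

  oddWords-+6 : ∀ k → oddWords (6 + k) + F (5 + k) ≡ F (8 + k) + oddWords k
  oddWords-+6 k = begin
    oddWords (6 + k) + F (5 + k)                       ≡⟨ cong (oddWords (6 + k) +_) (sym (oddWords-+3 k)) ⟩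
    oddWords (6 + k) + (oddWords (3 + k) + oddWords k) ≡⟨ sym (+-assoc (oddWords (6 + k)) _ _) ⟩
    oddWords (6 + k) + oddWords (3 + k) + oddWords k   ≡⟨ cong (_+ oddWords k) (oddWords-+3 (3 + k)) ⟩
    F (8 + k) + oddWords k                             ∎

  oddWords[1+6r] : ∀ r → 2 * oddWords (1 + r * 6) ≡ 1 + F (4 + r * 6)
  oddWords[1+6r] zero = refl
  oddWords[1+6r] (suc r) = +-cancelʳ-≡ (2 * F (6 + t)) _ _ (begin
    2 * oddWords (7 + t) + 2 * F (6 + t) ≡⟨ sym (*-distribˡ-+ 2 (oddWords (7 + t)) _) ⟩
    2 * (oddWords (7 + t) + F (6 + t))   ≡⟨ cong (2 *_) (oddWords-+6 (1 + t)) ⟩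
    2 * (F (9 + t) + oddWords (1 + t))   ≡⟨ *-distribˡ-+ 2 (F (9 + t)) _ ⟩
    2 * F (9 + t) + 2 * oddWords (1 + t) ≡⟨ cong (2 * F (9 + t) +_) (oddWords[1+6r] r) ⟩
    2 * F (9 + t) + (1 + F (4 + t))      ≡⟨ +-suc (2 * F (9 + t)) _ ⟩
    1 + (2 * F (9 + t) + F (4 + t))      ≡⟨ cong suc (2F[8+n]+F[3+n] (1 + t)) ⟩
    1 + F (10 + t) + 2 * F (6 + t)       ∎)
    where
    t = r * 6

  block : List Bool
  block = true ∷ false ∷ false ∷ true ∷ false ∷ false ∷ []

  length-blocks : ∀ r → length (concat (replicate r block)) ≡ r * 6
  length-blocks zero = refl
  length-blocks (suc r) = cong (6 +_) (length-blocks r)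

  nr-suc : ∀ r → nr (suc r) ≡ F (7 + r * 6) + (F (4 + r * 6) + nr r)
  nr-suc r rewrite length-blocks r | +-comm (r * 6) 2 = refl

  nr<F[2+6r] : ∀ r → nr r < F (2 + r * 6)
  nr<F[2+6r] zero = s≤s z≤n
  nr<F[2+6r] (suc r) rewrite nr-suc r =
    <-≤-trans (+-monoʳ-< (F (7 + t)) (+-monoʳ-< (F (4 + t)) (nr<F[2+6r] r)))
              (+-monoʳ-≤ (F (7 + t)) (≤-trans (+-monoʳ-≤ (F (4 + t)) (F-≤-suc (2 + t))) (F-≤-suc (5 + t))))
    where
    t = r * 6

  sumFtm-F+ : ∀ k {d} → d < F (2 + k) → sumFtm (F (3 + k) + d) + sumFtm d ≡ oddWords k + suc d
  sumFtm-F+ k {d} d<F = begin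
    sumFtm (F (3 + k) + d) + sumFtm d
      ≡⟨ cong₂ _+_ (sumFtm≡oddCount (suc k) (+-monoʳ-< (F (3 + k)) d<F))
                   (sumFtm≡oddCount k (<-≤-trans d<F (F-≤-suc (2 + k)))) ⟩
    oddCount (suc k) (suc (F (3 + k) + d)) + oddCount k (suc d)
      ≡⟨ cong (λ n → oddCount (suc k) n + oddCount k (suc d)) (sym (+-suc (F (3 + k)) d)) ⟩
    oddCount (suc k) (F (3 + k) + suc d) + oddCount k (suc d)
      ≡⟨ oddCount-split k (suc d) ⟩
    oddWords k + suc d
      ∎

  sumFtm-F+F+ : ∀ k {n} → n < F (2 + k) →
                sumFtm (F (6 + k) + (F (3 + k) + n)) + oddWords k ≡ oddWords (3 + k) + F (3 + k) + sumFtm n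
  sumFtm-F+F+ k {n} n<F = +-cancelʳ-≡ (suc n) _ _ (begin
    sumFtm N + oddWords k + suc n           ≡⟨ +-assoc (sumFtm N) (oddWords k) (suc n) ⟩
    sumFtm N + (oddWords k + suc n)         ≡⟨ cong (sumFtm N +_) (sym (sumFtm-F+ k n<F)) ⟩
    sumFtm N + (sumFtm m + sumFtm n)        ≡⟨ sym (+-assoc (sumFtm N) (sumFtm m) (sumFtm n)) ⟩
    sumFtm N + sumFtm m + sumFtm n          ≡⟨ cong (_+ sumFtm n) (sumFtm-F+ (3 + k) m<F[5+k]) ⟩
    oddWords (3 + k) + suc m + sumFtm n     ≡⟨ shift-suc (oddWords (3 + k)) (F (3 + k)) (sumFtm n) n ⟩
    oddWords (3 + k) + F (3 + k) + sumFtm n + suc n ∎)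
    where
    m = F (3 + k) + n
    N = F (6 + k) + m
    m<F[5+k] : m < F (5 + k)
    m<F[5+k] = <-≤-trans (+-monoʳ-< (F (3 + k)) n<F) (F-≤-suc (4 + k))
    shift-suc : ∀ a b c n → a + suc (b + n) + c ≡ a + b + c + suc n
    shift-suc = solve-∀

  sumFtm-nr-suc : ∀ r → sumFtm (nr (suc r)) + 1 ≡ sumFtm (nr r) + F (6 + r * 6)
  sumFtm-nr-suc r rewrite nr-suc r =
    +-telescope (sumFtm (F (7 + t) + (F (4 + t) + nr r))) Φ₁ (Φ₄ + F (4 + t))
      (sumFtm-F+F+ (1 + t) (<-≤-trans (nr<F[2+6r] r) (F-≤-suc (2 + t))))
      oddWords[4+6r]
    where
    t = r * 6
    Φ₁ = oddWords (1 + t)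
    Φ₄ = oddWords (4 + t)
    oddWords[4+6r] : Φ₄ + F (4 + t) + 1 ≡ Φ₁ + F (6 + t)
    oddWords[4+6r] = begin
      Φ₄ + F (4 + t) + 1   ≡⟨ +-assoc Φ₄ (F (4 + t)) 1 ⟩
      Φ₄ + (F (4 + t) + 1) ≡⟨ cong (Φ₄ +_) (+-comm (F (4 + t)) 1) ⟩
      Φ₄ + (1 + F (4 + t)) ≡⟨ cong (Φ₄ +_) (sym (oddWords[1+6r] r)) ⟩
      Φ₄ + 2 * Φ₁          ≡⟨ cong (λ x → Φ₄ + (Φ₁ + x)) (+-identityʳ Φ₁) ⟩
      Φ₄ + (Φ₁ + Φ₁)       ≡⟨ sym (+-assoc Φ₄ Φ₁ Φ₁) ⟩
      Φ₄ + Φ₁ + Φ₁         ≡⟨ cong (_+ Φ₁) (oddWords-+3 (1 + t)) ⟩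
      F (6 + t) + Φ₁       ≡⟨ +-comm (F (6 + t)) Φ₁ ⟩
      Φ₁ + F (6 + t)       ∎

  sumFtm-nr : ∀ r → 4 * sumFtm (nr r) + 4 * r + 2 ≡ F (3 + r * 6)
  sumFtm-nr zero = refl
  sumFtm-nr (suc r) = begin
    4 * sumFtm (nr (suc r)) + 4 * suc r + 2         ≡⟨ regroup (sumFtm (nr (suc r))) r ⟩
    4 * (sumFtm (nr (suc r)) + 1) + (4 * r + 2)     ≡⟨ cong (λ x → 4 * x + (4 * r + 2)) (sumFtm-nr-suc r) ⟩
    4 * (sumFtm (nr r) + F (6 + t)) + (4 * r + 2)   ≡⟨ distribute (sumFtm (nr r)) (F (6 + t)) r ⟩
    4 * F (6 + t) + (4 * sumFtm (nr r) + 4 * r + 2) ≡⟨ cong (4 * F (6 + t) +_) (sumFtm-nr r) ⟩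
    4 * F (6 + t) + F (3 + t)                       ≡⟨ sym (F[9+n] t) ⟩
    F (9 + t)                                       ∎
    where
    t = r * 6
    regroup : ∀ g r → 4 * g + 4 * suc r + 2 ≡ 4 * (g + 1) + (4 * r + 2)
    regroup = solve-∀
    distribute : ∀ g f r → 4 * (g + f) + (4 * r + 2) ≡ 4 * f + (4 * g + 4 * r + 2)
    distribute = solve-∀

  F[2+6r]-mod-4 : ∀ r → ∃ λ a → 4 * a + 1 ≡ F (2 + r * 6)
  F[2+6r]-mod-4 zero = 0 , refl
  F[2+6r]-mod-4 (suc r) with F[2+6r]-mod-4 r
  ... | a , 4a+1≡F = 5 * a + 2 * F (3 + t) + 1 , (begin
    4 * (5 * a + 2 * F (3 + t) + 1) + 1   ≡⟨ regroup a (F (3 + t)) ⟩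
    5 * (4 * a + 1) + 8 * F (3 + t)       ≡⟨ cong (λ x → 5 * x + 8 * F (3 + t)) 4a+1≡F ⟩
    5 * F (2 + t) + 8 * F (3 + t)         ≡⟨ sym (F[6+n] (2 + t)) ⟩
    F (8 + t)                             ∎)
    where
    t = r * 6
    regroup : ∀ a y → 4 * (5 * a + 2 * y + 1) + 1 ≡ 5 * (4 * a + 1) + 8 * y
    regroup = solve-∀

  6r+k≡k+r*6 : ∀ r k → 6 * r + k ≡ k + r * 6
  6r+k≡k+r*6 r k = trans (+-comm (6 * r) k) (cong (k +_) (*-comm 6 r))

open import Data.Nat using (ℕ)
import Data.Nat as ℕ
open import Data.Integer using (ℤ; +_; _+_; _-_; _*_)
open import Data.Integer.Properties using (pos-+; pos-*)
open import Data.Integer.Tactic.RingSolver using (solve)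

witness-equations : ∀ a g r {x y f : ℤ} →
  + 4 * a + + 1 ≡ x → + 4 * g + + 4 * r + + 2 ≡ y → f ≡ + 5 * x + + 8 * y →
  (+ 4 * a ≡ x - + 1) × (+ 32 * (g - a) ≡ f - + 13 * x - + 32 * r - + 8) × (g ≡ a + (g - a))
witness-equations a g r refl refl refl = solve (a ∷ []) , solve (a ∷ g ∷ r ∷ []) , solve (a ∷ g ∷ [])

pos-*-+ : ∀ c m n → + (c ℕ.* m ℕ.+ n) ≡ + c * + m + + n
pos-*-+ c m n = trans (pos-+ (c ℕ.* m) n) (cong (_+ + n) (pos-* c m))

pos-*-+-* : ∀ c m d n → + (c ℕ.* m ℕ.+ d ℕ.* n) ≡ + c * + m + + d * + n
pos-*-+-* c m d n = trans (pos-+ (c ℕ.* m) (d ℕ.* n)) (cong₂ _+_ (pos-* c m) (pos-* d n))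

mainTheorem18 : (r : ℕ) → ∃₂ λ (a b : ℤ) →
    (+ 4 * a ≡ + F (6 Data.Nat.* r Data.Nat.+ 2) - + 1)
    × (+ 32 * b ≡ + F (6 Data.Nat.* r Data.Nat.+ 8) - + 13 * + F (6 Data.Nat.* r Data.Nat.+ 2) - + 32 * + r - + 8)
    × (+ sumFtm (nr r) ≡ a + b)
mainTheorem18 r rewrite 6r+k≡k+r*6 r 2 | 6r+k≡k+r*6 r 8 with F[2+6r]-mod-4 r
... | a , 4a+1≡F = + a , + g - + a , witness-equations (+ a) (+ g) (+ r) 4a+1≡F[2+t] 4g+4r+2≡F[3+t] F[8+t]
  where
  t = r ℕ.* 6
  g = sumFtm (nr r)
  4a+1≡F[2+t] : + 4 * + a + + 1 ≡ + F (2 ℕ.+ t)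
  4a+1≡F[2+t] = trans (sym (pos-*-+ 4 a 1)) (cong +_ 4a+1≡F)
  4g+4r+2≡F[3+t] : + 4 * + g + + 4 * + r + + 2 ≡ + F (3 ℕ.+ t)
  4g+4r+2≡F[3+t] = trans (sym (trans (pos-+ _ 2) (cong (_+ + 2) (pos-*-+-* 4 g 4 r)))) (cong +_ (sumFtm-nr r))
  F[8+t] : + F (8 ℕ.+ t) ≡ + 5 * + F (2 ℕ.+ t) + + 8 * + F (3 ℕ.+ t)
  F[8+t] = trans (cong +_ (F[6+n] (2 ℕ.+ t))) (pos-*-+-* 5 (F (2 ℕ.+ t)) 8 (F (3 ℕ.+ t)))
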